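{- Let $k\ge 0$ and $n$ be integers with $n\ge 4k+3$. Then $$PF(n,n-k)-PF(n-2,n-k-2)=p(k),$$ where $p(k)$ is the number of partitions of $k$.
   Context: A partition $\lambda=(\lambda_1\ge\cdots\ge\lambda_\ell)$ of $n$ is a finite nonincreasing sequence of positive integers with sum $n$; $\ell(\lambda)$ is its number of parts; $p(0)=1$. The hook length $h_{(i,j)}(\lambda)$ of a cell $(i,j)$ of the Ferrers diagram is the number of cells consisting of the cell itself, the cells to its right in its row and the cells below it in its column. A numerical set is a subset $S\subseteq\mathbb{N}_0$ containing $0$ with finite complement; a numerical semigroup is a numerical set closed under addition. For a partition $\lambda$ let $S_\lambda=\mathbb{N}_0\setminus\{h_{(i,1)}(\lambda):1\le i\le\ell(\lambda)\}$. $PF(n,f)$ is the number of partitions $\lambda$ of $n$ with largest hook length $h_{(1,1)}(\lambda)=f$ such that $S_\lambda$ is a numerical semigroup. -}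

module Defs where

open import Data.Nat using (ℕ; zero; suc; _+_; _<_; _≥_)
open import Data.List using (List; []; _∷_; length)
open import Data.Nat.ListAction using (sum)
open import Data.List.Relation.Unary.All using (All)
open import Data.List.Relation.Unary.Linked using (Linked)
open import Data.List.Relation.Unary.Unique.Propositional using (Unique)
open import Data.List.Membership.Propositional using (_∈_; _∉_)
open import Data.Product using (_×_; Σ; ∃)
open import Function.Bundles using (_⇔_)
open import Relation.Binary.PropositionalEquality using (_≡_)

IsPartition : ℕ → List ℕ → Set
IsPartition n λs = Linked _≥_ λs × All (0 <_) λs × sum λs ≡ n

-- First-column hook lengths h_{(i,1)}, i = 1..ℓ:
-- h_{(i,1)} = λ_i (cells of row i) + (ℓ - i) (cells below in column 1),
-- and ℓ - i is the length of the tail after λ_i.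
firstColumnHooks : List ℕ → List ℕ
firstColumnHooks [] = []
firstColumnHooks (x ∷ xs) = (x + length xs) ∷ firstColumnHooks xs

LargestHook : List ℕ → ℕ → Set
LargestHook [] f = 0 ≡ f  -- never used (f ≥ 1 in the theorem); empty partition has no cells
LargestHook (x ∷ xs) f = x + length xs ≡ f

InS : List ℕ → ℕ → Set
InS λs a = a ∉ firstColumnHooks λs

-- numerical semigroup: contains 0 and closed under addition
-- (the complement is finite automatically here)
IsNumericalSemigroup : (ℕ → Set) → Set
IsNumericalSemigroup S = S 0 × (∀ a b → S a → S b → S (a + b))

PFSet : ℕ → ℕ → List ℕ → Set
PFSet n f λs = IsPartition n λs × LargestHook λs f × IsNumericalSemigroup (InS λs)

HasCount : (List ℕ → Set) → ℕ → Set
HasCount P m = Σ (List (List ℕ)) λ L → Unique L × (∀ x → (x ∈ L) ⇔ P x) × length L ≡ m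

-- Write F = n − k for the principal hook, so that λ has exactly k cells outside it. When F > 3k,
-- every positive nongap u of S_λ exceeds half of every hook below F, so S_λ is a numerical
-- semigroup iff F is not the sum of two positive nongaps. Such a λ has 1 as a gap, so its last part
-- is 1. If λ₁ > λ₂, deleting a cell of the first row together with the last row gives a partition
-- counted by PF(n − 2, F − 2); the nongaps below F just shift by one, so the criterion transfers in
-- both directions. If λ₁ = λ₂, deleting the first column and then the first row leaves a partition
-- of k, and conversely every partition of k arises in this way after padding with ones.

module Submission where

open import Defs
open import Data.Nat using (ℕ; zero; suc; _+_; _*_; _∸_; _≥_; _≤_; _<_; _≰_; z≤n; s≤s; z<s; _≤?_; _<?_; _≟_)
open import Data.Nat.Properties
open import Data.Nat.Tactic.RingSolver using (solve-∀)
open import Data.Nat.ListAction using (sum)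
open import Data.Nat.ListAction.Properties using (sum-++)
open import Data.List using (List; []; _∷_; _∷ʳ_; _++_; length; map; replicate; [_]; filter)
open import Data.List.Properties using (length-++; length-map; length-replicate; ∷-injective; ∷ʳ-injectiveˡ)
open import Data.List.Relation.Unary.Unique.Propositional using (Unique; []; _∷_)
import Data.List.Relation.Unary.Unique.Propositional.Properties as Unique
open import Data.List.Relation.Unary.All as All using (All; []; _∷_; all?)
import Data.List.Relation.Unary.All.Properties as All
open import Data.List.Relation.Unary.Linked as Linked using (Linked; []; [-]; _∷_; linked?)
open import Data.List.Membership.Propositional using (_∈_; _∉_)
open import Data.List.Relation.Unary.Any using (here; there)
open import Data.List.Membership.Propositional.Properties using (∈-map⁺; ∈-map⁻; ∈-++⁺ˡ; ∈-++⁺ʳ; ∈-++⁻; ∈-filter⁺; ∈-filter⁻)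
open import Data.Product as Product using (Σ; _×_; _,_; proj₁; proj₂; ∃)
open import Data.Sum using (_⊎_; inj₁; inj₂)
open import Data.Empty using (⊥-elim)
open import Relation.Nullary using (¬_; Dec; yes; no)
open import Relation.Nullary.Decidable using (map′; _×-dec_; _→-dec_; ¬?)
open import Data.List.Membership.DecPropositional _≟_ using (_∈?_)
open import Relation.Binary.PropositionalEquality hiding ([_])
open import Function using (_∘_)
open import Function.Bundles using (_⇔_; mk⇔; module Equivalence)

-- Partitions as lists and their first-column hooks

hooks : List ℕ → List ℕ
hooks = firstColumnHooks

Nonincreasing : List ℕ → Set
Nonincreasing = Linked _≥_

Positive : List ℕ → Set
Positive = All (0 <_)

firstPart : List ℕ → ℕ
firstPart []      = 0
firstPart (x ∷ _) = x

Image : (List ℕ → List ℕ) → (List ℕ → Set) → List ℕ → Set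
Image f P z = ∃ λ x → P x × z ≡ f x

Nonincreasing⇒All≤ : ∀ {x ys} → Nonincreasing (x ∷ ys) → All (_≤ x) ys
Nonincreasing⇒All≤ [-]        = []
Nonincreasing⇒All≤ (x≥y ∷ ys) = x≥y ∷ All.map (λ z≤y → ≤-trans z≤y x≥y) (Nonincreasing⇒All≤ ys)

All≤⇒Nonincreasing : ∀ {x ys} → All (_≤ x) ys → Nonincreasing ys → Nonincreasing (x ∷ ys)
All≤⇒Nonincreasing []          _  = [-]
All≤⇒Nonincreasing (y≤x ∷ _) ys = y≤x ∷ ys

firstPart≤ : ∀ {x xs} → Nonincreasing (x ∷ xs) → firstPart xs ≤ x
firstPart≤ [-]       = z≤n
firstPart≤ (x≥y ∷ _) = x≥y

firstPart≤⇒nonincreasing : ∀ {x xs} → firstPart xs ≤ x → Nonincreasing xs → Nonincreasing (x ∷ xs)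
firstPart≤⇒nonincreasing {xs = []}    _   _  = [-]
firstPart≤⇒nonincreasing {xs = _ ∷ _} y≤x lk = y≤x ∷ lk

∷ʳ-1-nonincreasing : ∀ {xs} → Nonincreasing xs → Positive xs → Nonincreasing (xs ∷ʳ 1)
∷ʳ-1-nonincreasing {[]}        _          _        = [-]
∷ʳ-1-nonincreasing {_ ∷ []}    _          (p ∷ _)  = p ∷ [-]
∷ʳ-1-nonincreasing {_ ∷ _ ∷ _} (x≥y ∷ lk) (_ ∷ ps) = x≥y ∷ ∷ʳ-1-nonincreasing lk ps

∷ʳ-nonincreasing⁻ : ∀ {zs a} → Nonincreasing (zs ∷ʳ a) → Nonincreasing zs
∷ʳ-nonincreasing⁻ {[]}         _          = []
∷ʳ-nonincreasing⁻ {_ ∷ []}     _          = [-]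
∷ʳ-nonincreasing⁻ {_ ∷ _ ∷ _}  (x≥y ∷ lk) = x≥y ∷ ∷ʳ-nonincreasing⁻ lk

length≤sum : ∀ {xs} → Positive xs → length xs ≤ sum xs
length≤sum []       = z≤n
length≤sum (p ∷ ps) = +-mono-≤ p (length≤sum ps)

length-∷ʳ-1 : ∀ ys → length (ys ∷ʳ 1) ≡ suc (length ys)
length-∷ʳ-1 ys = trans (length-++ ys) (+-comm (length ys) 1)

0∉hooks : ∀ {xs} → Positive xs → 0 ∉ hooks xs
0∉hooks {x ∷ xs} (p ∷ _)  (here 0≡h) = <⇒≢ (<-≤-trans p (m≤m+n x (length xs))) 0≡h
0∉hooks          (_ ∷ ps) (there h)  = 0∉hooks ps h

hook<head : ∀ {x ys h} → Nonincreasing (x ∷ ys) → h ∈ hooks ys → h < x + length ys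

hook≤head : ∀ {x ys h} → Nonincreasing (x ∷ ys) → h ∈ hooks (x ∷ ys) → h ≤ x + length ys
hook≤head _  (here refl) = ≤-refl
hook≤head lk (there h∈)  = <⇒≤ (hook<head lk h∈)

hook<head {x} {y ∷ ys} (x≥y ∷ lk) h∈ =
  ≤-<-trans (hook≤head lk h∈) (subst (y + length ys <_) (sym (+-suc x (length ys))) (s≤s (+-monoˡ-≤ (length ys) x≥y)))

∈-hooks-++⁺ʳ : ∀ ws {zs v} → v ∈ hooks zs → v ∈ hooks (ws ++ zs)
∈-hooks-++⁺ʳ []       v∈ = v∈
∈-hooks-++⁺ʳ (_ ∷ ws) v∈ = there (∈-hooks-++⁺ʳ ws v∈)

∈-hooks-replicate : ∀ o {v} → 1 ≤ v → v ≤ o → v ∈ hooks (replicate o 1)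
∈-hooks-replicate zero    1≤v v≤0 = ⊥-elim (<⇒≱ 1≤v v≤0)
∈-hooks-replicate (suc o) 1≤v v≤o with m≤n⇒m<n∨m≡n v≤o
... | inj₁ (s≤s v≤o) = there (∈-hooks-replicate o 1≤v v≤o)
... | inj₂ refl      = here (cong suc (sym (length-replicate o)))

hooks-∷ʳ-1 : ∀ ys → hooks (ys ∷ʳ 1) ≡ map suc (hooks ys) ∷ʳ 1
hooks-∷ʳ-1 []       = refl
hooks-∷ʳ-1 (y ∷ ys) = cong₂ _∷_ (trans (cong (y +_) (length-∷ʳ-1 ys)) (+-suc y (length ys))) (hooks-∷ʳ-1 ys)

1∈hooks⇒∷ʳ-1 : ∀ {xs} → Positive xs → 1 ∈ hooks xs → ∃ λ zs → xs ≡ zs ∷ʳ 1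
1∈hooks⇒∷ʳ-1 {suc zero ∷ []}    _        (here refl) = [] , refl
1∈hooks⇒∷ʳ-1 {suc zero ∷ _ ∷ _} _        (here ())
1∈hooks⇒∷ʳ-1 {suc (suc _) ∷ _}  _        (here ())
1∈hooks⇒∷ʳ-1 {x ∷ _}           (_ ∷ ps) (there 1∈) = Product.map (x ∷_) (cong (x ∷_)) (1∈hooks⇒∷ʳ-1 ps 1∈)

-- Adding and removing a first column

prependColumn : List ℕ → ℕ → List ℕ
prependColumn μ o = map suc μ ++ replicate o 1

length-prependColumn : ∀ μ o → length (prependColumn μ o) ≡ length μ + o
length-prependColumn μ o = trans (length-++ (map suc μ)) (cong₂ _+_ (length-map suc μ) (length-replicate o))

sum-map-suc : ∀ μ → sum (map suc μ) ≡ sum μ + length μ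
sum-map-suc []      = refl
sum-map-suc (a ∷ μ) = trans (cong (λ s → suc (a + s)) (sum-map-suc μ)) (regroup a (sum μ) (length μ))
  where
  regroup : ∀ a s l → suc (a + (s + l)) ≡ a + s + suc l
  regroup = solve-∀

sum-replicate-1 : ∀ o → sum (replicate o 1) ≡ o
sum-replicate-1 zero    = refl
sum-replicate-1 (suc o) = cong suc (sum-replicate-1 o)

sum-prependColumn : ∀ μ o → sum (prependColumn μ o) ≡ sum μ + length μ + o
sum-prependColumn μ o = trans (sum-++ (map suc μ) _) (cong₂ _+_ (sum-map-suc μ) (sum-replicate-1 o))

prependColumn-positive : ∀ μ o → Positive (prependColumn μ o)
prependColumn-positive μ o = All.++⁺ (All.map⁺ (All.universal (λ _ → z<s) μ)) (All.replicate⁺ o (z<s))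

replicate-1-nonincreasing : ∀ o → Nonincreasing (replicate o 1)
replicate-1-nonincreasing zero          = []
replicate-1-nonincreasing (suc zero)    = [-]
replicate-1-nonincreasing (suc (suc o)) = ≤-refl ∷ replicate-1-nonincreasing (suc o)

prependColumn-nonincreasing : ∀ {μ} o → Nonincreasing μ → Nonincreasing (prependColumn μ o)
prependColumn-nonincreasing {[]}        o _           = replicate-1-nonincreasing o
prependColumn-nonincreasing {a ∷ []}    zero _        = [-]
prependColumn-nonincreasing {a ∷ []}    (suc o) _     = z<s ∷ replicate-1-nonincreasing (suc o)
prependColumn-nonincreasing {a ∷ b ∷ μ} o (a≥b ∷ lk) = s≤s a≥b ∷ prependColumn-nonincreasing o lk

prependColumn-≤ : ∀ {μ} o → Nonincreasing μ → All (_≤ suc (firstPart μ)) (prependColumn μ o)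
prependColumn-≤ {[]}    o _  = All.replicate⁺ o (z<s)
prependColumn-≤ {a ∷ μ} o lk =
  All.++⁺ (All.map⁺ (s≤s ≤-refl ∷ All.map s≤s (Nonincreasing⇒All≤ lk))) (All.replicate⁺ o (z<s))

∈-hooks-prependColumn : ∀ μ o {v} → 1 ≤ v → v ≤ o → v ∈ hooks (prependColumn μ o)
∈-hooks-prependColumn μ o 1≤v v≤o = ∈-hooks-++⁺ʳ (map suc μ) (∈-hooks-replicate o 1≤v v≤o)

prependColumn-injective : ∀ {μ ν} o o′ → Positive μ → Positive ν →
                          prependColumn μ o ≡ prependColumn ν o′ → μ ≡ ν
prependColumn-injective {[]}        {[]}        _       _        _        _        _  = refl
prependColumn-injective {[]}        {zero ∷ _}  _       _        _        (() ∷ _) _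
prependColumn-injective {[]}        {suc _ ∷ _} (suc _) _        _        _        ()
prependColumn-injective {zero ∷ _}  {[]}        _       _        (() ∷ _) _        _
prependColumn-injective {suc _ ∷ _} {[]}        _       (suc _)  _        _        ()
prependColumn-injective {a ∷ μ}     {b ∷ ν}     o       o′       (_ ∷ pμ) (_ ∷ pν) eq =
  cong₂ _∷_ (suc-injective (proj₁ (∷-injective eq))) (prependColumn-injective o o′ pμ pν (proj₂ (∷-injective eq)))

-- On a partition the parts equal to 1 come last, so this removes the first column.
dropFirstColumn : List ℕ → List ℕ
dropFirstColumn (suc (suc a) ∷ xs) = suc a ∷ dropFirstColumn xs
dropFirstColumn _                  = []

onesCount : List ℕ → ℕ
onesCount (suc (suc a) ∷ xs) = onesCount xs
onesCount xs                 = length xs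

replicate-1-unique : ∀ {xs} → All (_≤ 1) xs → Positive xs → xs ≡ replicate (length xs) 1
replicate-1-unique []                  []       = refl
replicate-1-unique {suc zero ∷ _}    (_ ∷ xs≤1)   (_ ∷ ps) = cong (1 ∷_) (replicate-1-unique xs≤1 ps)
replicate-1-unique {suc (suc _) ∷ _} (s≤s () ∷ _) _

prependColumn-dropFirstColumn : ∀ {xs} → Nonincreasing xs → Positive xs → prependColumn (dropFirstColumn xs) (onesCount xs) ≡ xs
prependColumn-dropFirstColumn {[]}               _  _        = refl
prependColumn-dropFirstColumn {suc zero ∷ xs}    lk (_ ∷ ps) = sym (cong (1 ∷_) (replicate-1-unique (Nonincreasing⇒All≤ lk) ps))
prependColumn-dropFirstColumn {suc (suc a) ∷ xs} lk (_ ∷ ps) = cong (suc (suc a) ∷_) (prependColumn-dropFirstColumn (Linked.tail lk) ps)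

dropFirstColumn-nonincreasing : ∀ {xs} → Nonincreasing xs → Nonincreasing (dropFirstColumn xs)
dropFirstColumn-nonincreasing {suc (suc a) ∷ suc (suc b) ∷ xs} (s≤s a≥b ∷ lk) = a≥b ∷ dropFirstColumn-nonincreasing lk
dropFirstColumn-nonincreasing {suc (suc a) ∷ []}          _ = [-]
dropFirstColumn-nonincreasing {suc (suc a) ∷ zero ∷ _}    _ = [-]
dropFirstColumn-nonincreasing {suc (suc a) ∷ suc zero ∷ _} _ = [-]
dropFirstColumn-nonincreasing {[]}                        _ = []
dropFirstColumn-nonincreasing {zero ∷ _}                  _ = []
dropFirstColumn-nonincreasing {suc zero ∷ _}              _ = []

dropFirstColumn-positive : ∀ xs → Positive (dropFirstColumn xs)
dropFirstColumn-positive (suc (suc a) ∷ xs) = z<s ∷ dropFirstColumn-positive xs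
dropFirstColumn-positive []                 = []
dropFirstColumn-positive (zero ∷ _)         = []
dropFirstColumn-positive (suc zero ∷ _)     = []

suc-firstPart-dropFirstColumn : ∀ {a} xs → 0 < a → suc (firstPart (dropFirstColumn (a ∷ xs))) ≡ a
suc-firstPart-dropFirstColumn {suc zero}    _ _ = refl
suc-firstPart-dropFirstColumn {suc (suc a)} _ _ = refl

∈-hooks-prependColumn-of-small : ∀ {μ} o {v} → Positive μ → 1 ≤ v →
  v + sum (prependColumn μ o) ≤ length (prependColumn μ o) + length (prependColumn μ o) → v ∈ hooks (prependColumn μ o)
∈-hooks-prependColumn-of-small {μ} o {v} pμ 1≤v small = ∈-hooks-prependColumn μ o 1≤v v≤o
  where
  L = length μ
  v≤o : v ≤ o
  v≤o = +-cancelˡ-≤ (L + L + o) v o (begin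
    L + L + o + v                 ≡⟨ +-comm (L + L + o) v ⟩
    v + (L + L + o)               ≤⟨ +-monoʳ-≤ v (+-monoˡ-≤ o (+-monoˡ-≤ L (length≤sum pμ))) ⟩
    v + (sum μ + L + o)           ≡⟨ cong (v +_) (sym (sum-prependColumn μ o)) ⟩
    v + sum (prependColumn μ o)   ≤⟨ small ⟩
    length (prependColumn μ o) + length (prependColumn μ o) ≡⟨ cong₂ _+_ (length-prependColumn μ o) (length-prependColumn μ o) ⟩
    L + o + (L + o)               ≡⟨ regroup L o ⟩
    L + L + o + o                 ∎)
    where
    open ≤-Reasoning
    regroup : ∀ L o → L + o + (L + o) ≡ L + L + o + o
    regroup = solve-∀

-- The parts equal to 1 are the last o parts, contributing the gaps 1, …, o; the parts above 1
-- weigh at least 2 each.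
small⇒∈-hooks : ∀ {ys v} → Nonincreasing ys → Positive ys → 1 ≤ v →
                 v + sum ys ≤ length ys + length ys → v ∈ hooks ys
small⇒∈-hooks {ys} {v} lk ps 1≤v =
  subst (λ zs → v + sum zs ≤ length zs + length zs → v ∈ hooks zs) (prependColumn-dropFirstColumn lk ps)
        (∈-hooks-prependColumn-of-small (onesCount ys) (dropFirstColumn-positive ys) 1≤v)

-- The semigroup S_λ when the principal hook dominates

positive-closure⇒semigroup : ∀ {xs} → Positive xs →
  (∀ {a b} → 0 < a → 0 < b → a ∉ hooks xs → b ∉ hooks xs → a + b ∉ hooks xs) → IsNumericalSemigroup (InS xs)
positive-closure⇒semigroup {xs} ps closed⁺ = 0∉hooks ps , closed
  where
  closed : ∀ a b → a ∉ hooks xs → b ∉ hooks xs → a + b ∉ hooks xs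
  closed zero    _       _  b∉ = b∉
  closed (suc a) zero    a∉ _  = a∉ ∘ subst (_∈ hooks xs) (+-identityʳ (suc a))
  closed (suc a) (suc b) a∉ b∉ = closed⁺ z<s z<s a∉ b∉

1∈hooks-of-semigroup : ∀ {λs h} → IsNumericalSemigroup (InS λs) → h ∈ hooks λs → 1 ∈ hooks λs
1∈hooks-of-semigroup {λs} {h} (0∉ , closed) h∈ with 1 ∈? hooks λs
... | yes 1∈ = 1∈
... | no  1∉ = ⊥-elim (nongap h h∈)
  where
  nongap : ∀ n → n ∉ hooks λs
  nongap zero    = 0∉
  nongap (suc n) = subst (_∉ hooks λs) (+-comm n 1) (closed n 1 (nongap n) 1∉)

Decomposable : List ℕ → ℕ → Set
Decomposable λs f = ∃ λ s → ∃ λ t → 0 < s × 0 < t × s ∉ hooks λs × t ∉ hooks λs × s + t ≡ f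

-- λ = x ∷ ys has exactly k cells outside its principal hook x + length ys, which exceeds 3k.
record DominantHook (k x : ℕ) (ys : List ℕ) : Set where
  constructor dominantHook
  field
    nonincreasing : Nonincreasing (x ∷ ys)
    positive      : Positive (x ∷ ys)
    offHook       : sum ys ≡ length ys + k
    large         : 3 * k < x + length ys

head-hook≤nongap+k : ∀ {k y zs u} → Nonincreasing zs → Positive zs → sum (y ∷ zs) ≡ length (y ∷ zs) + k →
                     0 < u → u ∉ hooks zs → y + length zs ≤ u + k
head-hook≤nongap+k {k} {y} {zs} {u} lk ps off 0<u u∉ = +-cancelʳ-≤ (sum zs) (y + length zs) (u + k) (begin
  y + length zs + sum zs             ≡⟨ regroup y (length zs) (sum zs) ⟩
  length zs + (y + sum zs)           ≡⟨ cong (length zs +_) off ⟩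
  length zs + (suc (length zs) + k)  ≡⟨ regroup′ (length zs) k ⟩
  suc (length zs + length zs) + k    ≤⟨ +-monoˡ-≤ k (≰⇒> (u∉ ∘ small⇒∈-hooks lk ps 0<u)) ⟩
  u + sum zs + k                     ≡⟨ swap u (sum zs) k ⟩
  u + k + sum zs                     ∎)
  where
  open ≤-Reasoning
  regroup : ∀ y l s → y + l + s ≡ l + (y + s)
  regroup = solve-∀
  regroup′ : ∀ l k → l + (suc l + k) ≡ suc (l + l) + k
  regroup′ = solve-∀
  swap : ∀ u s k → u + s + k ≡ u + k + s
  swap = solve-∀

-- If u + u ≤ h₂ (the second hook), then either F − u is a nongap above h₂ making F
-- decomposable, or F ≤ u + h₂ ≤ 3k; here h₂ ≤ u + k because the nongap u is not small.
tail-hook<nongap+nongap : ∀ {k x y zs} → DominantHook k x (y ∷ zs) → ¬ Decomposable (x ∷ y ∷ zs) (x + length (y ∷ zs)) →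
                          ∀ {u h} → 0 < u → u ∉ hooks (x ∷ y ∷ zs) → h ∈ hooks (y ∷ zs) → h < u + u
tail-hook<nongap+nongap {k} {x} {y} {zs} (dominantHook (_ ∷ lk) (_ ∷ _ ∷ ps′) off 3k<F) indecomposable {u} 0<u u∉ h∈ =
  ≤-<-trans (hook≤head lk h∈) (≰⇒> 2u≰h₂)
  where
  F  = x + length (y ∷ zs)
  h₂ = y + length zs
  h₂≤u+k : h₂ ≤ u + k
  h₂≤u+k = head-hook≤nongap+k (Linked.tail lk) ps′ off 0<u (u∉ ∘ there ∘ there)
  2u≰h₂ : u + u ≰ h₂
  2u≰h₂ 2u≤h₂ with u + h₂ <? F
  ... | yes u+h₂<F = indecomposable (u , w , 0<u , <-≤-trans z<s h₂<w , u∉ , w∉ , u+w≡F)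
    where
    u≤F : u ≤ F
    u≤F = ≤-trans (m≤m+n u h₂) (<⇒≤ u+h₂<F)
    w = proj₁ (m≤n⇒∃[o]m+o≡n u≤F)
    u+w≡F = proj₂ (m≤n⇒∃[o]m+o≡n u≤F)
    h₂<w : h₂ < w
    h₂<w = +-cancelˡ-< u h₂ w (subst (u + h₂ <_) (sym u+w≡F) u+h₂<F)
    w∉ : w ∉ hooks (x ∷ y ∷ zs)
    w∉ (here w≡F)  = <⇒≢ (m<n+m w 0<u) (trans w≡F (sym u+w≡F))
    w∉ (there w∈) = <⇒≱ h₂<w (hook≤head lk w∈)
  ... | no u+h₂≮F = <⇒≱ 3k<F (begin
    F                ≤⟨ ≮⇒≥ u+h₂≮F ⟩
    u + h₂           ≤⟨ +-monoʳ-≤ u h₂≤u+k ⟩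
    u + (u + k)      ≤⟨ +-mono-≤ u≤k (+-monoˡ-≤ k u≤k) ⟩
    k + (k + k)      ≡⟨ triple k ⟩
    3 * k            ∎)
    where
    open ≤-Reasoning
    u≤k : u ≤ k
    u≤k = +-cancelˡ-≤ u u k (≤-trans 2u≤h₂ h₂≤u+k)
    triple : ∀ k → k + (k + k) ≡ 3 * k
    triple = solve-∀

nongap+nongap∉tail-hooks : ∀ {k x ys} → DominantHook k x ys → ¬ Decomposable (x ∷ ys) (x + length ys) →
                           ∀ {a b} → 0 < a → 0 < b → a ∉ hooks (x ∷ ys) → b ∉ hooks (x ∷ ys) → a + b ∉ hooks ys
nongap+nongap∉tail-hooks {ys = []}    _     _     _   _   _  _  ()
nongap+nongap∉tail-hooks {ys = _ ∷ _} shape indec {a} {b} 0<a 0<b a∉ b∉ a+b∈ with ≤-total a b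
... | inj₁ a≤b = <-irrefl refl (<-≤-trans (tail-hook<nongap+nongap shape indec 0<a a∉ a+b∈) (+-monoʳ-≤ a a≤b))
... | inj₂ b≤a = <-irrefl refl (<-≤-trans (tail-hook<nongap+nongap shape indec 0<b b∉ a+b∈) (+-monoˡ-≤ b b≤a))

semigroup⇔indecomposable : ∀ {k x ys} → DominantHook k x ys →
                           IsNumericalSemigroup (InS (x ∷ ys)) ⇔ (¬ Decomposable (x ∷ ys) (x + length ys))
semigroup⇔indecomposable shape = mk⇔
  (λ (_ , closed) (s , t , _ , _ , s∉ , t∉ , s+t≡F) → closed s t s∉ t∉ (here s+t≡F))
  (λ indec → positive-closure⇒semigroup (DominantHook.positive shape) λ where
     0<a 0<b a∉ b∉ (here a+b≡F) → indec (_ , _ , 0<a , 0<b , a∉ , b∉ , a+b≡F)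
     0<a 0<b a∉ b∉ (there a+b∈) → nongap+nongap∉tail-hooks shape indec 0<a 0<b a∉ b∉ a+b∈)

PFSet⇒DominantHook : ∀ {k F x ys} → 3 * k < F → PFSet (F + k) F (x ∷ ys) → DominantHook k x ys
PFSet⇒DominantHook {k} {F} {x} {ys} 3k<F ((lk , ps , sum≡) , F≡ , _) =
  dominantHook lk ps off (subst (3 * k <_) (sym F≡) 3k<F)
  where
  off : sum ys ≡ length ys + k
  off = +-cancelˡ-≡ x (sum ys) (length ys + k)
          (trans sum≡ (trans (cong (_+ k) (sym F≡)) (+-assoc x (length ys) k)))

DominantHook⇒PFSet : ∀ {k x ys} → DominantHook k x ys → IsNumericalSemigroup (InS (x ∷ ys)) →
                     PFSet (x + length ys + k) (x + length ys) (x ∷ ys)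
DominantHook⇒PFSet {k} {x} {ys} (dominantHook lk ps off _) S =
  (lk , ps , trans (cong (x +_) off) (sym (+-assoc x (length ys) k))) , refl , S

-- Growing the principal hook by two

extend : List ℕ → List ℕ
extend []       = []
extend (x ∷ ys) = suc x ∷ ys ∷ʳ 1

principal-hook-extend : ∀ x ys → suc x + length (ys ∷ʳ 1) ≡ 2 + (x + length ys)
principal-hook-extend x ys = cong suc (trans (cong (x +_) (length-∷ʳ-1 ys)) (+-suc x (length ys)))

1∈hooks-extend : ∀ x ys → 1 ∈ hooks (extend (x ∷ ys))
1∈hooks-extend x ys = there (subst (1 ∈_) (sym (hooks-∷ʳ-1 ys)) (∈-++⁺ʳ (map suc (hooks ys)) (here refl)))

suc-∈-hooks-extend : ∀ x ys {h} → h ∈ hooks ys → suc h ∈ hooks (extend (x ∷ ys))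
suc-∈-hooks-extend x ys h∈ = there (subst (_ ∈_) (sym (hooks-∷ʳ-1 ys)) (∈-++⁺ˡ (∈-map⁺ suc h∈)))

suc-∈-hooks-extend⁻ : ∀ x ys {s} → suc s ∈ hooks (extend (x ∷ ys)) → s ≡ suc (x + length ys) ⊎ s ∈ hooks ys ⊎ s ≡ 0
suc-∈-hooks-extend⁻ x ys (here s+1≡F) = inj₁ (suc-injective (trans s+1≡F (principal-hook-extend x ys)))
suc-∈-hooks-extend⁻ x ys {s} (there s+1∈) with ∈-++⁻ (map suc (hooks ys)) (subst (suc s ∈_) (hooks-∷ʳ-1 ys) s+1∈)
... | inj₁ s+1∈map with ∈-map⁻ suc s+1∈map
...   | h , h∈ , refl = inj₂ (inj₁ h∈)
suc-∈-hooks-extend⁻ x ys (there _) | inj₂ (here refl) = inj₂ (inj₂ refl)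

suc-∉-hooks-extend⇔ : ∀ x ys {s} → 0 < s → s < x + length ys →
                      s ∉ hooks (x ∷ ys) ⇔ suc s ∉ hooks (extend (x ∷ ys))
suc-∉-hooks-extend⇔ x ys {s} 0<s s<F = mk⇔ to from
  where
  to : s ∉ hooks (x ∷ ys) → suc s ∉ hooks (extend (x ∷ ys))
  to s∉ s+1∈ with suc-∈-hooks-extend⁻ x ys s+1∈
  ... | inj₁ s≡F+1     = <⇒≱ s<F (subst (x + length ys ≤_) (sym s≡F+1) (n≤1+n _))
  ... | inj₂ (inj₁ s∈) = s∉ (there s∈)
  ... | inj₂ (inj₂ s≡0) = <⇒≢ 0<s (sym s≡0)
  from : suc s ∉ hooks (extend (x ∷ ys)) → s ∉ hooks (x ∷ ys)
  from s+1∉ (here s≡F) = <⇒≢ s<F s≡F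
  from s+1∉ (there s∈) = s+1∉ (suc-∈-hooks-extend x ys s∈)

decomposable-extend⇔ : ∀ x ys →
  Decomposable (x ∷ ys) (x + length ys) ⇔ Decomposable (extend (x ∷ ys)) (suc x + length (ys ∷ʳ 1))
decomposable-extend⇔ x ys = mk⇔ to from
  where
  F = x + length ys
  shift : ∀ s t → suc (suc s) + suc (suc t) ≡ 2 + (suc s + suc t)
  shift = solve-∀
  to : Decomposable (x ∷ ys) F → Decomposable (extend (x ∷ ys)) (suc x + length (ys ∷ʳ 1))
  to (suc s , suc t , 0<s , 0<t , s∉ , t∉ , s+t≡F) =
    suc (suc s) , suc (suc t) , z<s , z<s ,
    Equivalence.to (suc-∉-hooks-extend⇔ x ys 0<s (subst (suc s <_) s+t≡F (m<m+n (suc s) 0<t))) s∉ ,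
    Equivalence.to (suc-∉-hooks-extend⇔ x ys 0<t (subst (suc t <_) s+t≡F (m<n+m (suc t) 0<s))) t∉ ,
    trans (shift s t) (trans (cong (2 +_) s+t≡F) (sym (principal-hook-extend x ys)))
  from : Decomposable (extend (x ∷ ys)) (suc x + length (ys ∷ʳ 1)) → Decomposable (x ∷ ys) F
  from (suc zero , _ , _ , _ , 1∉ , _ , _) = ⊥-elim (1∉ (1∈hooks-extend x ys))
  from (_ , suc zero , _ , _ , _ , 1∉ , _) = ⊥-elim (1∉ (1∈hooks-extend x ys))
  from (suc (suc s) , suc (suc t) , _ , _ , s∉ , t∉ , eq) =
    suc s , suc t , z<s , z<s ,
    Equivalence.from (suc-∉-hooks-extend⇔ x ys z<s (subst (suc s <_) s+t≡F (m<m+n (suc s) z<s))) s∉ ,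
    Equivalence.from (suc-∉-hooks-extend⇔ x ys z<s (subst (suc t <_) s+t≡F (m<n+m (suc t) z<s))) t∉ ,
    s+t≡F
    where
    s+t≡F : suc s + suc t ≡ F
    s+t≡F = suc-injective (suc-injective (trans (sym (shift s t)) (trans eq (principal-hook-extend x ys))))

extend-nonincreasing : ∀ {x ys} → Nonincreasing (x ∷ ys) → Positive ys → Nonincreasing (extend (x ∷ ys))
extend-nonincreasing {ys = []}    _          _  = z<s ∷ [-]
extend-nonincreasing {ys = _ ∷ _} (x≥y ∷ lk) ps = m≤n⇒m≤1+n x≥y ∷ ∷ʳ-1-nonincreasing lk ps

dominantHook-extend : ∀ {k x ys} → DominantHook k x ys → DominantHook k (suc x) (ys ∷ʳ 1)
dominantHook-extend {k} {x} {ys} (dominantHook lk (_ ∷ ps) off 3k<F) =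
  dominantHook (extend-nonincreasing lk ps) (z<s ∷ All.++⁺ ps (z<s ∷ [])) off′
               (<-≤-trans 3k<F (subst (x + length ys ≤_) (sym (principal-hook-extend x ys)) (m≤n+m _ 2)))
  where
  off′ : sum (ys ∷ʳ 1) ≡ length (ys ∷ʳ 1) + k
  off′ = begin
    sum (ys ∷ʳ 1)         ≡⟨ sum-++ ys [ 1 ] ⟩
    sum ys + 1            ≡⟨ cong (_+ 1) off ⟩
    length ys + k + 1     ≡⟨ regroup (length ys) k ⟩
    suc (length ys) + k   ≡⟨ cong (_+ k) (sym (length-∷ʳ-1 ys)) ⟩
    length (ys ∷ʳ 1) + k  ∎
    where
    open ≡-Reasoning
    regroup : ∀ l k → l + k + 1 ≡ suc l + k
    regroup = solve-∀

dominantHook-unextend : ∀ {k x zs} → DominantHook k (suc x) (zs ∷ʳ 1) → firstPart (zs ∷ʳ 1) ≤ x →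
                        3 * k < x + length zs → DominantHook k x zs
dominantHook-unextend {k} {x} {zs} (dominantHook lk (_ ∷ ps) off _) a≤x 3k<F =
  dominantHook (∷ʳ-nonincreasing⁻ {x ∷ zs} (firstPart≤⇒nonincreasing a≤x (Linked.tail lk)))
               (<-≤-trans (firstPart-positive zs ps) a≤x ∷ All.++⁻ˡ zs ps) off′ 3k<F
  where
  firstPart-positive : ∀ zs → Positive (zs ∷ʳ 1) → 0 < firstPart (zs ∷ʳ 1)
  firstPart-positive []      _       = z<s
  firstPart-positive (_ ∷ _) (p ∷ _) = p
  off′ : sum zs ≡ length zs + k
  off′ = +-cancelʳ-≡ 1 (sum zs) (length zs + k) (begin
    sum zs + 1            ≡⟨ sym (sum-++ zs [ 1 ]) ⟩
    sum (zs ∷ʳ 1)         ≡⟨ off ⟩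
    length (zs ∷ʳ 1) + k  ≡⟨ cong (_+ k) (length-∷ʳ-1 zs) ⟩
    suc (length zs) + k   ≡⟨ regroup (length zs) k ⟩
    length zs + k + 1     ∎)
    where
    open ≡-Reasoning
    regroup : ∀ l k → suc l + k ≡ l + k + 1
    regroup = solve-∀

semigroup-extend⇔ : ∀ {k x ys} → DominantHook k x ys →
                    IsNumericalSemigroup (InS (extend (x ∷ ys))) ⇔ IsNumericalSemigroup (InS (x ∷ ys))
semigroup-extend⇔ {x = x} {ys} shape = mk⇔
  (λ S′ → from small (λ dec → to large S′ (to decomposable dec)))
  (λ S → from large (λ dec′ → to small S (from decomposable dec′)))
  where
  open Equivalence
  small = semigroup⇔indecomposable shape
  large = semigroup⇔indecomposable (dominantHook-extend shape)
  decomposable = decomposable-extend⇔ x ys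

extend-PFSet : ∀ {k F y} → 3 * k < F → PFSet (F + k) F y → PFSet (2 + F + k) (2 + F) (extend y)
extend-PFSet {y = []}     3k<F (_ , 0≡F , _) = ⊥-elim (<⇒≢ (≤-<-trans z≤n 3k<F) 0≡F)
extend-PFSet {k} {y = x ∷ ys} 3k<F p@(_ , F≡ , S) =
  subst (λ f → PFSet (f + k) f (extend (x ∷ ys))) (trans (principal-hook-extend x ys) (cong (2 +_) F≡))
        (DominantHook⇒PFSet (dominantHook-extend shape) (Equivalence.from (semigroup-extend⇔ shape) S))
  where
  shape = PFSet⇒DominantHook 3k<F p

PFSet-extend⁻ : ∀ {k F x zs} → 3 * k < F → PFSet (2 + F + k) (2 + F) (suc x ∷ zs ∷ʳ 1) → firstPart (zs ∷ʳ 1) ≤ x →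
                PFSet (F + k) F (x ∷ zs)
PFSet-extend⁻ {k} {F} {x} {zs} 3k<F p@(_ , hook≡ , S) a≤x =
  subst (λ f → PFSet (f + k) f (x ∷ zs)) F≡ (DominantHook⇒PFSet shape (Equivalence.to (semigroup-extend⇔ shape) S))
  where
  F≡ : x + length zs ≡ F
  F≡ = suc-injective (suc-injective (trans (sym (principal-hook-extend x zs)) hook≡))
  shape : DominantHook k x zs
  shape = dominantHook-unextend (PFSet⇒DominantHook (<-≤-trans 3k<F (m≤n+m F 2)) p) a≤x (subst (3 * k <_) (sym F≡) 3k<F)

extend-injective : ∀ {y y′} → extend y ≡ extend y′ → y ≡ y′
extend-injective {[]}    {[]}     _  = refl
extend-injective {x ∷ ys} {x′ ∷ ys′} eq =
  cong₂ _∷_ (suc-injective (proj₁ (∷-injective eq))) (∷ʳ-injectiveˡ ys ys′ (proj₂ (∷-injective eq)))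

-- Partitions with equal first two parts

-- μ ↦ (μ₁+1, μ₁+1, μ₂+1, …, μ_ℓ+1, 1, …, 1), padded with ones until the principal hook is f.
embed : ℕ → List ℕ → List ℕ
embed f μ = suc (firstPart μ) ∷ prependColumn μ (f ∸ suc (firstPart μ) ∸ length μ)

principal-hook-embed : ∀ {f} μ → suc (firstPart μ) + length μ ≤ f →
                       suc (firstPart μ) + length (prependColumn μ (f ∸ suc (firstPart μ) ∸ length μ)) ≡ f
principal-hook-embed {f} μ h₁+L≤f = begin
  h₁ + length (prependColumn μ m)  ≡⟨ cong (h₁ +_) (length-prependColumn μ m) ⟩
  h₁ + (L + m)                     ≡⟨ regroup h₁ L m ⟩
  m + (h₁ + L)                     ≡⟨ cong (_+ (h₁ + L)) (∸-+-assoc f h₁ L) ⟩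
  f ∸ (h₁ + L) + (h₁ + L)          ≡⟨ m∸n+n≡m h₁+L≤f ⟩
  f                                ∎
  where
  open ≡-Reasoning
  h₁ = suc (firstPart μ)
  L  = length μ
  m  = f ∸ h₁ ∸ L
  regroup : ∀ a b c → a + (b + c) ≡ c + (a + b)
  regroup = solve-∀

suc-firstPart+length≤ : ∀ {k μ} → IsPartition k μ → suc (firstPart μ) + length μ ≤ 2 + k
suc-firstPart+length≤ {μ = []}    _                 = s≤s z≤n
suc-firstPart+length≤ {μ = a ∷ μ} (_ , _ ∷ ps , refl) =
  s≤s (≤-trans (≤-reflexive (+-suc a (length μ))) (s≤s (+-monoʳ-≤ a (length≤sum ps))))

suc-firstPart+length≤2+F : ∀ {k F μ} → 3 * k < F → IsPartition k μ → suc (firstPart μ) + length μ ≤ 2 + F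
suc-firstPart+length≤2+F {k} 3k<F p =
  ≤-trans (suc-firstPart+length≤ p) (+-monoʳ-≤ 2 (≤-trans (m≤m+n k (k + (k + 0))) (<⇒≤ 3k<F)))

embed-partition : ∀ {k f μ} → IsPartition k μ → suc (firstPart μ) + length μ ≤ f →
                  IsPartition (f + k) (embed f μ) × LargestHook (embed f μ) f
embed-partition {k} {f} {μ} (lkμ , _ , sumμ) h₁+L≤f =
  (All≤⇒Nonincreasing (prependColumn-≤ m lkμ) (prependColumn-nonincreasing m lkμ) , z<s ∷ prependColumn-positive μ m , sum≡) ,
  principal-hook-embed μ h₁+L≤f
  where
  h₁ = suc (firstPart μ)
  L  = length μ
  m  = f ∸ h₁ ∸ L
  sum≡ : h₁ + sum (prependColumn μ m) ≡ f + k
  sum≡ = begin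
    h₁ + sum (prependColumn μ m)  ≡⟨ cong (h₁ +_) (sum-prependColumn μ m) ⟩
    h₁ + (sum μ + L + m)          ≡⟨ cong (λ s → h₁ + (s + L + m)) sumμ ⟩
    h₁ + (k + L + m)              ≡⟨ regroup h₁ k L m ⟩
    h₁ + (L + m) + k              ≡⟨ cong (λ l → h₁ + l + k) (sym (length-prependColumn μ m)) ⟩
    h₁ + length (prependColumn μ m) + k ≡⟨ cong (_+ k) (principal-hook-embed μ h₁+L≤f) ⟩
    f + k                         ∎
    where
    open ≡-Reasoning
    regroup : ∀ a k b c → a + (k + b + c) ≡ a + (b + c) + k
    regroup = solve-∀

-- The trailing m ones make 1, …, m gaps, and m is more than half of the principal hook 2 + F,
-- so any two positive nongaps add up beyond every hook.
embed-semigroup : ∀ {k F μ} → 3 * k < F → IsPartition k μ → IsNumericalSemigroup (InS (embed (2 + F) μ))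
embed-semigroup {k} {F} {μ} 3k<F p@(lkμ , _ , _) = positive-closure⇒semigroup (z<s ∷ prependColumn-positive μ m)
  λ {a} {b} 0<a 0<b a∉ b∉ a+b∈ → <⇒≱ (2+F<a+b 0<a 0<b a∉ b∉) (subst (a + b ≤_) hook≡ (hook≤head lk a+b∈))
  where
  h₁ = suc (firstPart μ)
  L  = length μ
  m  = 2 + F ∸ h₁ ∸ L
  h₁+L≤k+2 : h₁ + L ≤ 2 + k
  h₁+L≤k+2 = suc-firstPart+length≤ p
  lk : Nonincreasing (embed (2 + F) μ)
  lk = All≤⇒Nonincreasing (prependColumn-≤ m lkμ) (prependColumn-nonincreasing m lkμ)
  hook≡ : h₁ + length (prependColumn μ m) ≡ 2 + F
  hook≡ = principal-hook-embed μ (suc-firstPart+length≤2+F 3k<F p)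
  F≤m+k : F ≤ m + k
  F≤m+k = +-cancelˡ-≤ 2 F (m + k) (begin
    2 + F                          ≡⟨ sym hook≡ ⟩
    h₁ + length (prependColumn μ m) ≡⟨ cong (h₁ +_) (length-prependColumn μ m) ⟩
    h₁ + (L + m)                   ≤⟨ ≤-reflexive (regroup h₁ L m) ⟩
    m + (h₁ + L)                   ≤⟨ +-monoʳ-≤ m h₁+L≤k+2 ⟩
    m + (2 + k)                    ≡⟨ regroup′ m k ⟩
    2 + (m + k)                    ∎)
    where
    open ≤-Reasoning
    regroup : ∀ a b c → a + (b + c) ≡ c + (a + b)
    regroup = solve-∀
    regroup′ : ∀ m k → m + (2 + k) ≡ 2 + (m + k)
    regroup′ = solve-∀
  k<m : k < m
  k<m = ≤-<-trans (m≤m+n k k) (+-cancelʳ-< k (k + k) m (subst (_< m + k) (triple k) (<-≤-trans 3k<F F≤m+k)))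
    where
    triple : ∀ k → 3 * k ≡ k + k + k
    triple = solve-∀
  m<nongap : ∀ {a} → 0 < a → a ∉ hooks (embed (2 + F) μ) → m < a
  m<nongap 0<a a∉ = ≰⇒> (λ a≤m → a∉ (there (∈-hooks-prependColumn μ m 0<a a≤m)))
  2+F<a+b : ∀ {a b} → 0 < a → 0 < b → a ∉ hooks (embed (2 + F) μ) → b ∉ hooks (embed (2 + F) μ) → 2 + F < a + b
  2+F<a+b 0<a 0<b a∉ b∉ =
    <-≤-trans (subst (2 + F <_) (sym (+-suc (suc m) m)) (s≤s (s≤s (≤-<-trans F≤m+k (+-monoʳ-< m k<m)))))
              (+-mono-≤ (m<nongap 0<a a∉) (m<nongap 0<b b∉))

embed-PFSet : ∀ {k F μ} → 3 * k < F → IsPartition k μ → PFSet (2 + F + k) (2 + F) (embed (2 + F) μ)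
embed-PFSet 3k<F p = Product.map₂ (_, embed-semigroup 3k<F p)
  (embed-partition p (suc-firstPart+length≤2+F 3k<F p))

embed-dropFirstColumn : ∀ {k x xs} → Nonincreasing xs → Positive xs → sum xs ≡ length xs + k → 0 < x → x ≡ firstPart xs →
                        IsPartition k (dropFirstColumn xs) × x ∷ xs ≡ embed (x + length xs) (dropFirstColumn xs)
embed-dropFirstColumn {xs = []} _ _ _ 0<x x≡0 = ⊥-elim (<⇒≢ 0<x (sym x≡0))
embed-dropFirstColumn {k} {x} {xs@(_ ∷ r)} lk ps off _ x≡a =
  (dropFirstColumn-nonincreasing lk , dropFirstColumn-positive xs , sumμ≡k) , cong₂ _∷_ x≡h₁ tail≡
  where
  μ = dropFirstColumn xs
  o = onesCount xs
  L = length μ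
  xs≡ : xs ≡ prependColumn μ o
  xs≡ = sym (prependColumn-dropFirstColumn lk ps)
  length≡ : length xs ≡ L + o
  length≡ = trans (cong length xs≡) (length-prependColumn μ o)
  x≡h₁ : x ≡ suc (firstPart μ)
  x≡h₁ = trans x≡a (sym (suc-firstPart-dropFirstColumn r (All.head ps)))
  o≡ : x + length xs ∸ suc (firstPart μ) ∸ L ≡ o
  o≡ = begin
    x + length xs ∸ suc (firstPart μ) ∸ L ≡⟨ cong (λ h → x + length xs ∸ h ∸ L) (sym x≡h₁) ⟩
    x + length xs ∸ x ∸ L                 ≡⟨ cong (_∸ L) (m+n∸m≡n x (length xs)) ⟩
    length xs ∸ L                         ≡⟨ cong (_∸ L) length≡ ⟩
    L + o ∸ L                             ≡⟨ m+n∸m≡n L o ⟩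
    o                                     ∎
    where open ≡-Reasoning
  tail≡ : xs ≡ prependColumn μ (x + length xs ∸ suc (firstPart μ) ∸ L)
  tail≡ = trans xs≡ (cong (prependColumn μ) (sym o≡))
  sumμ≡k : sum μ ≡ k
  sumμ≡k = +-cancelˡ-≡ (L + o) (sum μ) k (begin
    L + o + sum μ       ≡⟨ regroup L o (sum μ) ⟩
    sum μ + L + o       ≡⟨ sym (sum-prependColumn μ o) ⟩
    sum (prependColumn μ o) ≡⟨ cong sum (sym xs≡) ⟩
    sum xs              ≡⟨ off ⟩
    length xs + k       ≡⟨ cong (_+ k) length≡ ⟩
    L + o + k           ∎)
    where
    open ≡-Reasoning
    regroup : ∀ l o s → l + o + s ≡ s + l + o
    regroup = solve-∀

embed-injective : ∀ f {μ ν} → Positive μ → Positive ν → embed f μ ≡ embed f ν → μ ≡ ν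
embed-injective f pμ pν eq = prependColumn-injective _ _ pμ pν (proj₂ (∷-injective eq))

-- The first two parts of embed f μ are equal, those of extend y are not.
extend≢embed : ∀ f {y μ} → Nonincreasing y → Positive y → extend y ≢ embed f μ
extend≢embed f {[]} _ _ ()
extend≢embed f {x ∷ _}     {[]}    _         (0<x ∷ _) eq = <⇒≢ 0<x (sym (suc-injective (proj₁ (∷-injective eq))))
extend≢embed f {x ∷ []}    {a ∷ _} _         (0<x ∷ _) eq with ∷-injective eq
... | x+1≡a+1 , tail≡ = <⇒≢ 0<x (sym (trans (suc-injective x+1≡a+1) (sym (suc-injective (proj₁ (∷-injective tail≡))))))
extend≢embed f {x ∷ z ∷ _} {a ∷ _} (x≥z ∷ _) _       eq with ∷-injective eq
... | x+1≡a+1 , tail≡ = 1+n≰n (subst (_≤ x) (trans (proj₁ (∷-injective tail≡)) (cong suc (sym (suc-injective x+1≡a+1)))) x≥z)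

PFSet-decomposition : ∀ {k F λs} → 3 * k < F → PFSet (2 + F + k) (2 + F) λs →
                      Image extend (PFSet (F + k) F) λs ⊎ Image (embed (2 + F)) (IsPartition k) λs
PFSet-decomposition {λs = []} _ (_ , () , _)
PFSet-decomposition {F = F} {x ∷ xs} 3k<F p@((lk , ps , _) , hook≡ , S) with x ≟ firstPart xs
... | yes x≡a =
  inj₂ (dropFirstColumn xs , proj₁ embedded , trans (proj₂ embedded) (cong (λ f → embed f (dropFirstColumn xs)) hook≡))
  where
  off = DominantHook.offHook (PFSet⇒DominantHook (<-≤-trans 3k<F (m≤n+m F 2)) p)
  embedded = embed-dropFirstColumn (Linked.tail lk) (All.tail ps) off (All.head ps) x≡a
... | no x≢a with 1∈hooks-of-semigroup S (here (sym hook≡)) | ≤∧≢⇒< (firstPart≤ lk) (x≢a ∘ sym)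
...   | here 1≡F     | _             = ⊥-elim (0≢1+n (suc-injective (trans 1≡F hook≡)))
...   | there 1∈     | s≤s a≤x₀ with 1∈hooks⇒∷ʳ-1 (All.tail ps) 1∈
...     | zs , refl = inj₁ (_ ∷ zs , PFSet-extend⁻ 3k<F p a≤x₀ , refl)

-- Counting

unique-map : ∀ {P : List ℕ → Set} {f : List ℕ → List ℕ} {xs} → (∀ {x y} → P x → P y → f x ≡ f y → x ≡ y) →
             All P xs → Unique xs → Unique (map f xs)
unique-map inj []         []           = []
unique-map inj (px ∷ pxs) (x∉xs ∷ uxs) =
  All.map⁺ (All.zipWith (λ (x≢y , py) fx≡fy → x≢y (inj px py fx≡fy)) (x∉xs , pxs)) ∷ unique-map inj pxs uxs

HasCount-image-⊎ : ∀ {P R Q : List ℕ → Set} {a b} (f g : List ℕ → List ℕ) → HasCount P a → HasCount R b →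
  (∀ {x y} → P x → P y → f x ≡ f y → x ≡ y) → (∀ {x y} → R x → R y → g x ≡ g y → x ≡ y) →
  (∀ {x y} → P x → R y → f x ≢ g y) → (∀ z → Q z ⇔ (Image f P z ⊎ Image g R z)) → HasCount Q (a + b)
HasCount-image-⊎ {P} {R} {Q} f g (LP , uP , ∈P , refl) (LR , uR , ∈R , refl) injP injR f≢g Q⇔ =
  map f LP ++ map g LR , unique , ∈⇔ , trans (length-++ (map f LP)) (cong₂ _+_ (length-map f LP) (length-map g LR))
  where
  allP : All P LP
  allP = All.tabulate (Equivalence.to (∈P _))
  allR : All R LR
  allR = All.tabulate (Equivalence.to (∈R _))
  unique : Unique (map f LP ++ map g LR)
  unique = Unique.++⁺ (unique-map injP allP uP) (unique-map injR allR uR) disjoint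
    where
    disjoint : ∀ {z} → ¬ (z ∈ map f LP × z ∈ map g LR)
    disjoint (z∈f , z∈g) with ∈-map⁻ f z∈f | ∈-map⁻ g z∈g
    ... | x , x∈ , refl | y , y∈ , fx≡gy = f≢g (Equivalence.to (∈P x) x∈) (Equivalence.to (∈R y) y∈) fx≡gy
  ∈⇔ : ∀ z → z ∈ map f LP ++ map g LR ⇔ Q z
  ∈⇔ z = mk⇔ to from
    where
    to : z ∈ map f LP ++ map g LR → Q z
    to z∈ with ∈-++⁻ (map f LP) z∈
    ... | inj₁ z∈f with ∈-map⁻ f z∈f
    ...   | x , x∈ , z≡fx = Equivalence.from (Q⇔ z) (inj₁ (x , Equivalence.to (∈P x) x∈ , z≡fx))
    to z∈ | inj₂ z∈g with ∈-map⁻ g z∈g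
    ...   | y , y∈ , z≡gy = Equivalence.from (Q⇔ z) (inj₂ (y , Equivalence.to (∈R y) y∈ , z≡gy))
    from : Q z → z ∈ map f LP ++ map g LR
    from qz with Equivalence.to (Q⇔ z) qz
    ... | inj₁ (x , px , refl) = ∈-++⁺ˡ (∈-map⁺ f (Equivalence.from (∈P x) px))
    ... | inj₂ (y , ry , refl) = ∈-++⁺ʳ (map f LP) (∈-map⁺ g (Equivalence.from (∈R y) ry))

HasCount-⊆ : ∀ {P Q : List ℕ → Set} {m} → HasCount P m → (∀ {x} → Q x → P x) → (∀ x → Dec (Q x)) →
             ∃ λ m′ → HasCount Q m′
HasCount-⊆ {Q = Q} (L , unique , ∈⇔ , _) Q⇒P Q? = _ , filter Q? L , Unique.filter⁺ Q? unique , ∈⇔′ , refl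
  where
  ∈⇔′ : ∀ x → x ∈ filter Q? L ⇔ Q x
  ∈⇔′ x = mk⇔ (proj₂ ∘ ∈-filter⁻ Q? {xs = L}) (λ q → ∈-filter⁺ Q? (Equivalence.from (∈⇔ x) (Q⇒P q)) q)

-- The partitions of n with all parts ≤ j, all of them as soon as n + j < fuel.
boundedPartitions : (fuel n j : ℕ) → List (List ℕ)
boundedPartitions zero       _       _       = []
boundedPartitions (suc fuel) zero    _       = [ [] ]
boundedPartitions (suc fuel) (suc n) zero    = []
boundedPartitions (suc fuel) (suc n) (suc j) with j ≤? n
... | yes _ = boundedPartitions fuel (suc n) j ++ map (suc j ∷_) (boundedPartitions fuel (n ∸ j) (suc j))
... | no  _ = boundedPartitions fuel (suc n) j

BoundedPartition : ℕ → ℕ → List ℕ → Set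
BoundedPartition n j x = IsPartition n x × All (_≤ j) x

boundedPartitions-sound : ∀ fuel n j {x} → x ∈ boundedPartitions fuel n j → BoundedPartition n j x
boundedPartitions-sound (suc fuel) zero j (here refl) = ([] , [] , refl) , []
boundedPartitions-sound (suc fuel) (suc n) (suc j) x∈ with j ≤? n
... | no _ = Product.map₂ (All.map m≤n⇒m≤1+n) (boundedPartitions-sound fuel (suc n) j x∈)
... | yes j≤n with ∈-++⁻ (boundedPartitions fuel (suc n) j) x∈
...   | inj₁ x∈ʲ = Product.map₂ (All.map m≤n⇒m≤1+n) (boundedPartitions-sound fuel (suc n) j x∈ʲ)
...   | inj₂ x∈ʲ⁺¹ with ∈-map⁻ (suc j ∷_) x∈ʲ⁺¹
...     | r , r∈ , refl with boundedPartitions-sound fuel (n ∸ j) (suc j) r∈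
...       | (lk , ps , sum≡) , r≤ =
  (All≤⇒Nonincreasing r≤ lk , z<s ∷ ps , cong suc (trans (cong (j +_) sum≡) (m+[n∸m]≡n j≤n))) , ≤-refl ∷ r≤

bounded-by-head : ∀ {a j n r} → a ≤ j → Nonincreasing (a ∷ r) → Positive (a ∷ r) → a + sum r ≡ n →
                  BoundedPartition n j (a ∷ r)
bounded-by-head a≤j lk ps sum≡ = (lk , ps , sum≡) , a≤j ∷ All.map (λ b≤a → ≤-trans b≤a a≤j) (Nonincreasing⇒All≤ lk)

boundedPartitions-complete : ∀ fuel n j {x} → n + j < fuel → BoundedPartition n j x → x ∈ boundedPartitions fuel n j
boundedPartitions-complete (suc fuel) zero    j       {[]}    _ _ = here refl
boundedPartitions-complete (suc fuel) zero    j       {_ ∷ _} _ ((_ , 0<a ∷ _ , sum≡) , _) =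
  ⊥-elim (<⇒≱ 0<a (m+n≤o⇒m≤o _ (≤-reflexive sum≡)))
boundedPartitions-complete (suc fuel) (suc n) j       {[]}    _ ((_ , _ , ()) , _)
boundedPartitions-complete (suc fuel) (suc n) zero    {_ ∷ _} _ ((_ , 0<a ∷ _ , _) , a≤0 ∷ _) = ⊥-elim (<⇒≱ 0<a a≤0)
boundedPartitions-complete (suc fuel) (suc n) (suc j) {a ∷ r} (s≤s bound) ((lk , ps , sum≡) , a≤j+1 ∷ _)
  with j ≤? n | m≤n⇒m<n∨m≡n a≤j+1
... | yes _   | inj₁ (s≤s a≤j) = ∈-++⁺ˡ (boundedPartitions-complete fuel (suc n) j (subst (_< fuel) (+-suc n j) bound)
                                                                  (bounded-by-head a≤j lk ps sum≡))
... | no  _   | inj₁ (s≤s a≤j) = boundedPartitions-complete fuel (suc n) j (subst (_< fuel) (+-suc n j) bound)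
                                                           (bounded-by-head a≤j lk ps sum≡)
... | yes j≤n | inj₂ refl = ∈-++⁺ʳ (boundedPartitions fuel (suc n) j) (∈-map⁺ (suc j ∷_)
      (boundedPartitions-complete fuel (n ∸ j) (suc j) fuel-bound ((Linked.tail lk , All.tail ps , sum-r) , Nonincreasing⇒All≤ lk)))
  where
  sum-r : sum r ≡ n ∸ j
  sum-r = sym (trans (cong (_∸ j) (sym (suc-injective sum≡))) (m+n∸m≡n j (sum r)))
  fuel-bound : n ∸ j + suc j < fuel
  fuel-bound = ≤-<-trans (≤-reflexive (trans (+-suc (n ∸ j) j) (cong suc (m∸n+n≡m j≤n))))
                         (≤-<-trans (≤-trans (s≤s (m≤m+n n j)) (≤-reflexive (sym (+-suc n j)))) bound)
... | no j≰n  | inj₂ refl = ⊥-elim (j≰n (≤-pred (subst (suc j ≤_) sum≡ (m≤m+n (suc j) (sum r)))))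

boundedPartitions-unique : ∀ fuel n j → Unique (boundedPartitions fuel n j)
boundedPartitions-unique zero       _       _       = []
boundedPartitions-unique (suc fuel) zero    _       = [] ∷ []
boundedPartitions-unique (suc fuel) (suc n) zero    = []
boundedPartitions-unique (suc fuel) (suc n) (suc j) with j ≤? n
... | no  _ = boundedPartitions-unique fuel (suc n) j
... | yes _ = Unique.++⁺ (boundedPartitions-unique fuel (suc n) j)
                         (Unique.map⁺ (proj₂ ∘ ∷-injective) (boundedPartitions-unique fuel (n ∸ j) (suc j))) disjoint
  where
  disjoint : ∀ {x} → ¬ (x ∈ boundedPartitions fuel (suc n) j × x ∈ map (suc j ∷_) (boundedPartitions fuel (n ∸ j) (suc j)))
  disjoint (x∈ʲ , x∈ʲ⁺¹) with ∈-map⁻ (suc j ∷_) x∈ʲ⁺¹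
  ... | _ , _ , refl with boundedPartitions-sound fuel (suc n) j x∈ʲ
  ...   | _ , j+1≤j ∷ _ = 1+n≰n j+1≤j

partitions : ℕ → List (List ℕ)
partitions n = boundedPartitions (suc (n + n)) n n

All≤sum : ∀ xs → All (_≤ sum xs) xs
All≤sum []       = []
All≤sum (a ∷ xs) = m≤m+n a (sum xs) ∷ All.map (λ b≤ → ≤-trans b≤ (m≤n+m (sum xs) a)) (All≤sum xs)

HasCount-IsPartition : ∀ n → HasCount (IsPartition n) (length (partitions n))
HasCount-IsPartition n = partitions n , boundedPartitions-unique (suc (n + n)) n n , ∈⇔ , refl
  where
  ∈⇔ : ∀ x → x ∈ partitions n ⇔ IsPartition n x
  ∈⇔ x = mk⇔ (proj₁ ∘ boundedPartitions-sound (suc (n + n)) n n)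
             (λ p@(_ , _ , sum≡) → boundedPartitions-complete (suc (n + n)) n n ≤-refl
                                      (p , subst (λ s → All (_≤ s) x) sum≡ (All≤sum x)))

hook≤sum+length : ∀ xs {h} → h ∈ hooks xs → h ≤ sum xs + length xs
hook≤sum+length (a ∷ xs) (here refl) = +-mono-≤ (m≤m+n a (sum xs)) (n≤1+n (length xs))
hook≤sum+length (a ∷ xs) (there h∈)  =
  ≤-trans (hook≤sum+length xs h∈) (+-mono-≤ (m≤n+m (sum xs) a) (n≤1+n (length xs)))

IsNumericalSemigroup? : ∀ xs → Dec (IsNumericalSemigroup (InS xs))
IsNumericalSemigroup? xs =
  map′ from-bounded to-bounded (¬? (0 ∈? hooks xs) ×-dec allUpTo? (λ a → allUpTo? (λ b → closed? a b) B) B)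
  where
  B = suc (sum xs + length xs)  -- exceeds every hook
  Closed : ℕ → ℕ → Set
  Closed a b = a ∉ hooks xs → b ∉ hooks xs → a + b ∉ hooks xs
  closed? : ∀ a b → Dec (Closed a b)
  closed? a b = ¬? (a ∈? hooks xs) →-dec (¬? (b ∈? hooks xs) →-dec ¬? (a + b ∈? hooks xs))
  from-bounded : 0 ∉ hooks xs × (∀ {a} → a < B → ∀ {b} → b < B → Closed a b) → IsNumericalSemigroup (InS xs)
  from-bounded (0∉ , closed) = 0∉ , closed′
    where
    closed′ : ∀ a b → Closed a b
    closed′ a b a∉ b∉ a+b∈ = closed (s≤s (≤-trans (m≤m+n a b) (hook≤sum+length xs a+b∈)))
                                    (s≤s (≤-trans (m≤n+m b a) (hook≤sum+length xs a+b∈))) a∉ b∉ a+b∈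
  to-bounded : IsNumericalSemigroup (InS xs) → 0 ∉ hooks xs × (∀ {a} → a < B → ∀ {b} → b < B → Closed a b)
  to-bounded (0∉ , closed) = 0∉ , λ {a} _ {b} _ → closed a b

IsPartition? : ∀ n xs → Dec (IsPartition n xs)
IsPartition? n xs = linked? (λ a b → b ≤? a) xs ×-dec all? (0 <?_) xs ×-dec sum xs ≟ n

LargestHook? : ∀ xs f → Dec (LargestHook xs f)
LargestHook? []       f = 0 ≟ f
LargestHook? (x ∷ xs) f = x + length xs ≟ f

PFSet? : ∀ n f xs → Dec (PFSet n f xs)
PFSet? n f xs = IsPartition? n xs ×-dec LargestHook? xs f ×-dec IsNumericalSemigroup? xs

PF-recurrence : ∀ k F → 3 * k < F →
  Σ ℕ λ a → Σ ℕ λ b → Σ ℕ λ c →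
    HasCount (PFSet (2 + F + k) (2 + F)) a × HasCount (PFSet (F + k) F) b × HasCount (IsPartition k) c × a ≡ b + c
PF-recurrence k F 3k<F with HasCount-⊆ (HasCount-IsPartition (F + k)) proj₁ (PFSet? (F + k) F)
... | b , countB = b + c , b , c , countA , countB , countC , refl
  where
  c = length (partitions k)
  countC = HasCount-IsPartition k
  countA : HasCount (PFSet (2 + F + k) (2 + F)) (b + c)
  countA = HasCount-image-⊎ extend (embed (2 + F)) countB countC
    (λ _ _ → extend-injective)
    (λ (_ , pμ , _) (_ , pν , _) → embed-injective (2 + F) pμ pν)
    (λ {_} {μ} ((lk , ps , _) , _) _ → extend≢embed (2 + F) {μ = μ} lk ps)
    (λ _ → mk⇔ (PFSet-decomposition 3k<F) λ
      { (inj₁ (y , p , refl)) → extend-PFSet 3k<F p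
      ; (inj₂ (μ , p , refl)) → embed-PFSet 3k<F p })

principal-hook-split : ∀ k n → n ≥ 4 * k + 3 → ∃ λ F → 2 + F + k ≡ n × 3 * k < F
principal-hook-split k n n≥ with m≤n⇒∃[o]m+o≡n n≥
... | o , refl = suc (3 * k + o) , regroup k o , s≤s (m≤m+n (3 * k) o)
  where
  regroup : ∀ k o → 2 + suc (3 * k + o) + k ≡ 4 * k + 3 + o
  regroup = solve-∀

theorem4p4 : (k n : ℕ) → n ≥ 4 * k + 3 →
    Σ ℕ λ a → Σ ℕ λ b → Σ ℕ λ c →
      HasCount (PFSet n (n ∸ k)) a × HasCount (PFSet (n ∸ 2) (n ∸ k ∸ 2)) b
        × HasCount (IsPartition k) c × a ≡ b + c
theorem4p4 k n n≥ with principal-hook-split k n n≥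
... | F , refl , 3k<F rewrite m+n∸n≡m (2 + F) k = PF-recurrence k F 3k<F
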